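{- Let $\mathbb F$ be a field, let $G$ be a graph and $D$ an orientation of $G$. If $\psi$ and $\psi'$ are switching-equivalent $(\mathbb F^+\rtimes\mathbb F^\times)$-gain functions on $G$, then $A(D,\psi)$ and $A(D,\psi')$ are projectively equivalent.
   Context: $\mathbb F^+\rtimes\mathbb F^\times$ is the group on $\mathbb F\times\mathbb F^\times$ with $(a,b)\circ(c,d)=(a+bc,bd)$, identity $(0,1)$. A $\Gamma$-gain function on a graph $G$ (loops and parallel edges allowed) maps each oriented edge $(e,u,v)$ to $\Gamma$, with $\psi(e,u,v)=\psi(e,v,u)^{ -1}$ for $u\ne v$. Gain functions $\psi,\psi'$ are switching-equivalent if there is $\eta:V(G)\to\Gamma$ with $\psi'(e,u,v)=\eta(u)^{ -1}\psi(e,u,v)\eta(v)$ for all oriented edges. An orientation $D$ of $G$ chooses for each edge $e$ one oriented edge $(e,v,w)$. The matrix $A(D,\psi)$ over $\mathbb F$ has rows indexed by $V(G)\cup\{v_0\}$ ($v_0\notin V(G)$) and columns by $E(G)$: if $e$ is oriented in $D$ from $v$ to $w$ and $\psi(e,v,w)=(a,b)$, the entry in row $u$, column $e$ is $a$ if $u=v_0$; $1$ if $u=v\ne w$; $-b$ if $u=w\ne v$; $1-b$ if $u=v=w$; $0$ otherwise. Two matrices are projectively equivalent if one can be obtained from the other by elementary row operations and scaling columns by nonzero scalars. -}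

module Defs where

open import Level using (Level; _⊔_; suc)
open import Algebra.Bundles using (CommutativeRing)
open import Data.Nat using (ℕ)
open import Data.Fin using (Fin; zero; suc; _≟_)
open import Data.Product using (Σ; _×_; _,_; proj₁; proj₂)
open import Data.Sum using (_⊎_)
open import Relation.Nullary using (¬_; yes; no)
open import Relation.Binary.PropositionalEquality using (_≡_; _≢_)

record Field (c ℓ : Level) : Set (Level.suc (c ⊔ ℓ)) where
  field
    commutativeRing : CommutativeRing c ℓ
  open CommutativeRing commutativeRing public
  field
    0≉1     : ¬ (0# ≈ 1#)
    inv     : (x : Carrier) → ¬ (x ≈ 0#) → Carrier
    inverse : (x : Carrier) (x≉0 : ¬ (x ≈ 0#)) → x * inv x x≉0 ≈ 1#

-- Graphs (loops and parallel edges allowed): vertex set Fin n, edge set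
-- Fin m, each edge has two (possibly equal) ends, stored as a pair whose
-- order carries no meaning.

record Graph : Set where
  field
    nV   : ℕ
    nE   : ℕ
    ends : Fin nE → Fin nV × Fin nV

open Graph public

IsOriented : (G : Graph) → Fin (nE G) → Fin (nV G) → Fin (nV G) → Set
IsOriented G e u v = (ends G e ≡ (u , v)) ⊎ (ends G e ≡ (v , u))

Orientation : Graph → Set
Orientation G = (e : Fin (nE G)) → Σ (Fin (nV G) × Fin (nV G))
                  (λ vw → IsOriented G e (proj₁ vw) (proj₂ vw))

module SemiDirect {c ℓ} (F : Field c ℓ) where
  open Field F

  record Γ : Set (c ⊔ ℓ) where
    constructor ⟨_,_∣_⟩
    field
      fst : Carrier
      snd : Carrier
      snd≉0 : ¬ (snd ≈ 0#)
  open Γ public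

  _≈Γ_ : Γ → Γ → Set ℓ
  g ≈Γ h = (fst g ≈ fst h) × (snd g ≈ snd h)

  private
    mul0 : ∀ {x} y → x ≈ 0# → y * x ≈ 0#
    mul0 {x} y x≈0 = trans (*-congˡ x≈0) (zeroʳ y)

    prod≉0 : ∀ {b d} → ¬ (b ≈ 0#) → ¬ (d ≈ 0#) → ¬ ((b * d) ≈ 0#)
    prod≉0 {b} {d} b≉0 d≉0 bd≈0 = d≉0 d≈0
      where
      ib = inv b b≉0
      d≈0 : d ≈ 0#
      d≈0 = trans (sym (*-identityˡ d))
            (trans (*-congʳ (sym (trans (*-comm ib b) (inverse b b≉0))))
            (trans (*-assoc ib b d) (mul0 ib bd≈0)))

    inv≉0 : ∀ {b} (b≉0 : ¬ (b ≈ 0#)) → ¬ (inv b b≉0 ≈ 0#)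
    inv≉0 {b} b≉0 i≈0 = 0≉1 (trans (sym (mul0 b i≈0)) (inverse b b≉0))

  _∘Γ_ : Γ → Γ → Γ
  ⟨ a , b ∣ b≉0 ⟩ ∘Γ ⟨ c' , d ∣ d≉0 ⟩ = ⟨ a + b * c' , b * d ∣ prod≉0 b≉0 d≉0 ⟩

  εΓ : Γ
  εΓ = ⟨ 0# , 1# ∣ (λ 1≈0 → 0≉1 (sym 1≈0)) ⟩

  _⁻¹Γ : Γ → Γ
  ⟨ a , b ∣ b≉0 ⟩ ⁻¹Γ = ⟨ - (a * inv b b≉0) , inv b b≉0 ∣ inv≉0 b≉0 ⟩

module GainGraphs {c ℓ} (F : Field c ℓ) where
  open Field F
  open SemiDirect F public

  -- A Γ-gain function on G: a value ψ e u v on every oriented edge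
  -- (e , u , v) (values on non-oriented-edge triples are irrelevant and
  -- never used), with ψ(e,u,v) = ψ(e,v,u)⁻¹ whenever u ≠ v.
  record GainFunction (G : Graph) : Set (c ⊔ ℓ) where
    field
      gain : Fin (nE G) → Fin (nV G) → Fin (nV G) → Γ
      gain-inv : ∀ e u v → IsOriented G e u v → u ≢ v →
                 gain e u v ≈Γ (gain e v u ⁻¹Γ)
  open GainFunction public

  SwitchingEquivalent : (G : Graph) → GainFunction G → GainFunction G → Set (c ⊔ ℓ)
  SwitchingEquivalent G ψ ψ' =
    Σ (Fin (nV G) → Γ) λ η →
      ∀ e u v → IsOriented G e u v →
        gain ψ' e u v ≈Γ ((η u ⁻¹Γ) ∘Γ (gain ψ e u v ∘Γ η v))

  Matrix : ℕ → ℕ → Set c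
  Matrix r k = Fin r → Fin k → Carrier

  -- The matrix A(D, ψ). Rows: Fin (suc n), where row zero is the extra
  -- vertex v₀ and row (suc u) is vertex u. Columns: edges.
  A : (G : Graph) → Orientation G → GainFunction G → Matrix (Data.Nat.suc (nV G)) (nE G)
  A G D ψ zero e = fst (gain ψ e (proj₁ (proj₁ (D e))) (proj₂ (proj₁ (D e))))
  A G D ψ (suc u) e with u ≟ proj₁ (proj₁ (D e)) | u ≟ proj₂ (proj₁ (D e))
  ... | yes _ | yes _ = 1# - snd (gain ψ e (proj₁ (proj₁ (D e))) (proj₂ (proj₁ (D e))))
  ... | yes _ | no _  = 1#
  ... | no _  | yes _ = - snd (gain ψ e (proj₁ (proj₁ (D e))) (proj₂ (proj₁ (D e))))
  ... | no _  | no _  = 0#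

  swapRows : ∀ {r k} → Fin r → Fin r → Matrix r k → Matrix r k
  swapRows i j M x with x ≟ i | x ≟ j
  ... | yes _ | _     = M j
  ... | no _  | yes _ = M i
  ... | no _  | no _  = M x

  scaleRow : ∀ {r k} → Fin r → Carrier → Matrix r k → Matrix r k
  scaleRow i s M x y with x ≟ i
  ... | yes _ = s * M x y
  ... | no _  = M x y

  addRow : ∀ {r k} → Fin r → Fin r → Carrier → Matrix r k → Matrix r k
  addRow i j s M x y with x ≟ i
  ... | yes _ = M i y + s * M j y
  ... | no _  = M x y

  scaleCol : ∀ {r k} → Fin k → Carrier → Matrix r k → Matrix r k
  scaleCol j s M x y with y ≟ j
  ... | yes _ = M x y * s
  ... | no _  = M x y

  data ProjEquiv {r k} : Matrix r k → Matrix r k → Set (c ⊔ ℓ) where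
    done     : ∀ {M N} → (∀ x y → M x y ≈ N x y) → ProjEquiv M N
    swapR    : ∀ {M N} i j → ProjEquiv (swapRows i j M) N → ProjEquiv M N
    scaleR   : ∀ {M N} i s → ¬ (s ≈ 0#) → ProjEquiv (scaleRow i s M) N → ProjEquiv M N
    addR     : ∀ {M N} i j s → i ≢ j → ProjEquiv (addRow i j s M) N → ProjEquiv M N
    scaleC   : ∀ {M N} j s → ¬ (s ≈ 0#) → ProjEquiv (scaleCol j s M) N → ProjEquiv M N

-- Write η u = (c_u , q_u).  In A(D, ψ) the column of an edge e from v to w with gain (a , b)
-- is a in row v₀ and δ_v - b δ_w on the vertex rows, while switching replaces the gain by
-- ((a - c_v + b c_w) / q_v , b q_w / q_v).  Hence A(D, ψ') is obtained from A(D, ψ) by adding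
-- -c_u times row u to row v₀ for every vertex u, multiplying row u by q_u, and dividing
-- column e by q_v.

{-# OPTIONS --safe #-}
module Submission where

open import Level using (Level; _⊔_)
open import Defs
open import Data.Bool using (if_then_else_)
open import Data.Fin using (Fin; zero; suc; _≟_)
open import Data.Nat using (zero; suc)
open import Data.Product using (Σ; _,_; proj₁; proj₂)
open import Data.Vec.Functional using (Vector; _∷_; tail; updateAt)
open import Data.Vec.Functional.Properties using (updateAt-updates; updateAt-minimal)
open import Function using (id; const; _∘_)
open import Relation.Nullary using (¬_; yes; no; does)
open import Relation.Binary.PropositionalEquality as ≡ using (_≡_; _≗_)
import Algebra.Properties.Ring as RingProperties
import Algebra.Properties.Semiring.Sum as Sum
import Algebra.Solver.Ring.NaturalCoefficients.Default as Solver

updateAt-induction : ∀ {a p} {A : Set a} {n} (P : Vector A n → Set p) (x₀ : A) →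
                     (∀ {f g} → f ≗ g → P f → P g) →
                     P (const x₀) →
                     (∀ f i x → f i ≡ x₀ → P f → P (updateAt f i (const x))) →
                     ∀ f → P f
updateAt-induction {n = zero}  P x₀ resp base step f = resp (λ ()) base
updateAt-induction {n = suc n} P x₀ resp base step f =
  resp (λ { zero → ≡.refl ; (suc i) → ≡.refl })
       (updateAt-induction (λ g → P (f zero ∷ g)) x₀ resp′ base′ step′ (tail f))
  where
  resp′ : ∀ {g h} → g ≗ h → P (f zero ∷ g) → P (f zero ∷ h)
  resp′ g≗h = resp (λ { zero → ≡.refl ; (suc i) → g≗h i })

  base′ : P (f zero ∷ const x₀)
  base′ =
    resp (λ { zero → ≡.refl ; (suc i) → ≡.refl }) (step (const x₀) zero (f zero) ≡.refl base)

  step′ : ∀ g i x → g i ≡ x₀ → P (f zero ∷ g) → P (f zero ∷ updateAt g i (const x))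
  step′ g i x gi≡x₀ =
    resp (λ { zero → ≡.refl ; (suc j) → ≡.refl }) ∘ step (f zero ∷ g) (suc i) x gi≡x₀

source target : ∀ {G} → Orientation G → Fin (nE G) → Fin (nV G)
source D e = proj₁ (proj₁ (D e))
target D e = proj₂ (proj₁ (D e))

module _ {c ℓ} (F : Field c ℓ) where
  open Field F hiding (zero)
  open GainGraphs F
  open RingProperties ring using (-‿distribˡ-*; -‿distribʳ-*; -‿involutive)
  open Sum semiring using (sum-syntax; sum-cong-≋; sum-replicate-zero; ∑-distrib-+; *-distribʳ-sum)
  open Solver commutativeSemiring using (solve; _:=_; _:+_; _:*_)
  open import Relation.Binary.Reasoning.Setoid setoid

  infix 4 _≋_
  _≋_ : ∀ {r k} → Matrix r k → Matrix r k → Set ℓ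
  M ≋ N = ∀ x y → M x y ≈ N x y

  swapRows-cong : ∀ {r k} i j {M N : Matrix r k} → M ≋ N → swapRows i j M ≋ swapRows i j N
  swapRows-cong i j M≋N x y with x ≟ i | x ≟ j
  ... | yes _ | _     = M≋N j y
  ... | no _  | yes _ = M≋N i y
  ... | no _  | no _  = M≋N x y

  scaleRow-cong : ∀ {r k} i s {M N : Matrix r k} → M ≋ N → scaleRow i s M ≋ scaleRow i s N
  scaleRow-cong i s M≋N x y with x ≟ i
  ... | yes _ = *-congˡ (M≋N x y)
  ... | no _  = M≋N x y

  addRow-cong : ∀ {r k} i j s {M N : Matrix r k} → M ≋ N → addRow i j s M ≋ addRow i j s N
  addRow-cong i j s M≋N x y with x ≟ i
  ... | yes _ = +-cong (M≋N i y) (*-congˡ (M≋N j y))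
  ... | no _  = M≋N x y

  scaleCol-cong : ∀ {r k} j s {M N : Matrix r k} → M ≋ N → scaleCol j s M ≋ scaleCol j s N
  scaleCol-cong j s M≋N x y with y ≟ j
  ... | yes _ = *-congʳ (M≋N x y)
  ... | no _  = M≋N x y

  ProjEquiv-respˡ : ∀ {r k} {L M N : Matrix r k} → L ≋ M → ProjEquiv M N → ProjEquiv L N
  ProjEquiv-respˡ L≋M (done M≋N)         = done (λ x y → trans (L≋M x y) (M≋N x y))
  ProjEquiv-respˡ L≋M (swapR i j p)      = swapR i j (ProjEquiv-respˡ (swapRows-cong i j L≋M) p)
  ProjEquiv-respˡ L≋M (scaleR i s s≉0 p) = scaleR i s s≉0 (ProjEquiv-respˡ (scaleRow-cong i s L≋M) p)
  ProjEquiv-respˡ L≋M (addR i j s i≢j p) = addR i j s i≢j (ProjEquiv-respˡ (addRow-cong i j s L≋M) p)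
  ProjEquiv-respˡ L≋M (scaleC j s s≉0 p) = scaleC j s s≉0 (ProjEquiv-respˡ (scaleCol-cong j s L≋M) p)

  ProjEquiv-trans : ∀ {r k} {L M N : Matrix r k} → ProjEquiv L M → ProjEquiv M N → ProjEquiv L N
  ProjEquiv-trans (done L≋M)         q = ProjEquiv-respˡ L≋M q
  ProjEquiv-trans (swapR i j p)      q = swapR i j (ProjEquiv-trans p q)
  ProjEquiv-trans (scaleR i s s≉0 p) q = scaleR i s s≉0 (ProjEquiv-trans p q)
  ProjEquiv-trans (addR i j s i≢j p) q = addR i j s i≢j (ProjEquiv-trans p q)
  ProjEquiv-trans (scaleC j s s≉0 p) q = scaleC j s s≉0 (ProjEquiv-trans p q)

  ProjEquiv-respʳ : ∀ {r k} {L M N : Matrix r k} → ProjEquiv L M → M ≋ N → ProjEquiv L N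
  ProjEquiv-respʳ p M≋N = ProjEquiv-trans p (done M≋N)

  addRowsToTop : ∀ {n k m} → (Fin k → Fin n) → (Fin k → Carrier) →
                 Matrix (suc n) m → Matrix (suc n) m
  addRowsToTop {k = k} ι a M zero y    = M zero y + ∑[ j < k ] (a j * M (suc (ι j)) y)
  addRowsToTop         ι a M (suc x) y = M (suc x) y

  ProjEquiv-addRowsToTop : ∀ {n m} k (ι : Fin k → Fin n) a (M : Matrix (suc n) m) →
                           ProjEquiv M (addRowsToTop ι a M)
  ProjEquiv-addRowsToTop zero ι a M = done λ { zero y → sym (+-identityʳ _) ; (suc x) y → refl }
  ProjEquiv-addRowsToTop (suc k) ι a M =
    addR zero (suc (ι zero)) (a zero) (λ ())
      (ProjEquiv-respʳ (ProjEquiv-addRowsToTop k (ι ∘ suc) (a ∘ suc) _) regroup)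
    where
    regroup : addRowsToTop (ι ∘ suc) (a ∘ suc) (addRow zero (suc (ι zero)) (a zero) M) ≋
              addRowsToTop ι a M
    regroup zero    y = +-assoc _ _ _
    regroup (suc x) y = refl

  Nonzero : Set (c ⊔ ℓ)
  Nonzero = Σ Carrier (λ x → ¬ x ≈ 0#)

  one : Nonzero
  one = 1# , 0≉1 ∘ sym

  scaleRows : ∀ {r k} → (Fin r → Carrier) → Matrix r k → Matrix r k
  scaleRows q M x y = q x * M x y

  scaleCols : ∀ {r k} → (Fin k → Carrier) → Matrix r k → Matrix r k
  scaleCols s M x y = M x y * s y

  ProjEquiv-scaleRows : ∀ {r k} (q : Fin r → Nonzero) (M : Matrix r k) →
                        ProjEquiv M (scaleRows (proj₁ ∘ q) M)
  ProjEquiv-scaleRows q M = updateAt-induction P one resp base step q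
    where
    P : Vector Nonzero _ → Set _
    P q = ProjEquiv M (scaleRows (proj₁ ∘ q) M)

    resp : ∀ {f g} → f ≗ g → P f → P g
    resp f≗g p = ProjEquiv-respʳ p λ x y → *-congʳ (reflexive (≡.cong proj₁ (f≗g x)))

    base : P (const one)
    base = done λ x y → sym (*-identityˡ _)

    step : ∀ f i s → f i ≡ one → P f → P (updateAt f i (const s))
    step f i s′@(s , s≉0) fi≡one p = ProjEquiv-trans p (scaleR i s s≉0 (done rescaled))
      where
      rescaled : scaleRow i s (scaleRows (proj₁ ∘ f) M) ≋
                 scaleRows (proj₁ ∘ updateAt f i (const s′)) M
      rescaled x y with x ≟ i
      ... | yes ≡.refl rewrite updateAt-updates i {const s′} f | fi≡one = *-congˡ (*-identityˡ _)
      ... | no x≢i     rewrite updateAt-minimal x i {const s′} f x≢i = refl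

  ProjEquiv-scaleCols : ∀ {r k} (s : Fin k → Nonzero) (M : Matrix r k) →
                        ProjEquiv M (scaleCols (proj₁ ∘ s) M)
  ProjEquiv-scaleCols s M = updateAt-induction P one resp base step s
    where
    P : Vector Nonzero _ → Set _
    P s = ProjEquiv M (scaleCols (proj₁ ∘ s) M)

    resp : ∀ {f g} → f ≗ g → P f → P g
    resp f≗g p = ProjEquiv-respʳ p λ x y → *-congˡ (reflexive (≡.cong proj₁ (f≗g y)))

    base : P (const one)
    base = done λ x y → sym (*-identityʳ _)

    step : ∀ f j t → f j ≡ one → P f → P (updateAt f j (const t))
    step f j t′@(t , t≉0) fj≡one p = ProjEquiv-trans p (scaleC j t t≉0 (done rescaled))
      where
      rescaled : scaleCol j t (scaleCols (proj₁ ∘ f) M) ≋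
                 scaleCols (proj₁ ∘ updateAt f j (const t′)) M
      rescaled x y with y ≟ j
      ... | yes ≡.refl rewrite updateAt-updates j {const t′} f | fj≡one = *-congʳ (*-identityʳ _)
      ... | no y≢j     rewrite updateAt-minimal y j {const t′} f y≢j = refl

  δ : ∀ {n} → Fin n → Fin n → Carrier
  δ i j = if does (i ≟ j) then 1# else 0#

  ∑-*δ : ∀ {n} (f : Fin n → Carrier) j → ∑[ i < n ] (f i * δ i j) ≈ f j
  ∑-*δ {suc n} f zero = begin
    f zero * 1# + ∑[ i < n ] (f (suc i) * 0#)
      ≈⟨ +-cong (*-identityʳ _) (sum-cong-≋ {n} (λ i → zeroʳ (f (suc i)))) ⟩
    f zero + ∑[ i < n ] 0#                     ≈⟨ +-congˡ (sum-replicate-zero n) ⟩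
    f zero + 0#                                ≈⟨ +-identityʳ _ ⟩
    f zero                                     ∎
  ∑-*δ {suc n} f (suc j) = trans (+-cong (zeroʳ _) (∑-*δ (f ∘ suc) j)) (+-identityˡ _)

  δ-*-cong : ∀ {n} (f : Fin n → Carrier) i j → δ i j * f i ≈ δ i j * f j
  δ-*-cong f i j with i ≟ j
  ... | yes ≡.refl = refl
  ... | no _       = trans (zeroˡ _) (sym (zeroˡ _))

  column : ∀ {n} → Γ → Fin n → Fin n → Fin (suc n) → Carrier
  column g v w zero    = fst g
  column g v w (suc u) = δ u v + δ u w * - snd g

  ∑-*column : ∀ {n} (f : Fin n → Carrier) g v w →
              ∑[ u < n ] (f u * column g v w (suc u)) ≈ f v + f w * - snd g
  ∑-*column {n} f g v w = begin
    ∑[ u < n ] (f u * (δ u v + δ u w * b))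
      ≈⟨ sum-cong-≋ {n} (λ u → trans (distribˡ _ _ _) (+-congˡ (sym (*-assoc _ _ _)))) ⟩
    ∑[ u < n ] (f u * δ u v + f u * δ u w * b)
      ≈⟨ ∑-distrib-+ (λ u → f u * δ u v) (λ u → f u * δ u w * b) ⟩
    ∑[ u < n ] (f u * δ u v) + ∑[ u < n ] (f u * δ u w * b)
      ≈⟨ +-congˡ (sym (*-distribʳ-sum b (λ u → f u * δ u w))) ⟩
    ∑[ u < n ] (f u * δ u v) + ∑[ u < n ] (f u * δ u w) * b
      ≈⟨ +-cong (∑-*δ f v) (*-congʳ (∑-*δ f w)) ⟩
    f v + f w * b
      ∎
    where
    b = - snd g

  columns : ∀ {n m} → (Fin m → Fin n) → (Fin m → Fin n) → (Fin m → Γ) → Matrix (suc n) m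
  columns v w t x e = column (t e) (v e) (w e) x

  A≋columns : ∀ G (D : Orientation G) ψ →
              A G D ψ ≋ columns (source D) (target D) (λ e → gain ψ e (source D e) (target D e))
  A≋columns G D ψ zero    e = refl
  A≋columns G D ψ (suc u) e with u ≟ source D e | u ≟ target D e
  ... | yes _ | yes _ = +-congˡ (sym (*-identityˡ _))
  ... | yes _ | no _  = sym (trans (+-congˡ (zeroˡ _)) (+-identityʳ _))
  ... | no _  | yes _ = sym (trans (+-identityˡ _) (*-identityˡ _))
  ... | no _  | no _  = sym (trans (+-identityˡ _) (zeroˡ _))

  snd× : Γ → Nonzero
  snd× g = snd g , snd≉0 g

  -x*-y≈x*y : ∀ x y → - x * - y ≈ x * y
  -x*-y≈x*y x y =
    trans (sym (-‿distribˡ-* x (- y))) (trans (-‿cong (sym (-‿distribʳ-* x y))) (-‿involutive _))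

  x*-y*z≈-[x*y*z] : ∀ x y z → x * - y * z ≈ - (x * y * z)
  x*-y*z≈-[x*y*z] x y z = trans (*-congʳ (sym (-‿distribʳ-* x y))) (sym (-‿distribˡ-* (x * y) z))

  switch-topEntry : ∀ g ηv ηw →
                    (fst g + (- fst ηv + - fst ηw * - snd g)) * snd (ηv ⁻¹Γ) ≈
                    fst ((ηv ⁻¹Γ) ∘Γ (g ∘Γ ηw))
  switch-topEntry g ηv ηw = begin
    (a + (- cv + - cw * - b)) * i
      ≈⟨ *-congʳ (+-congˡ (+-congˡ (-x*-y≈x*y cw b))) ⟩
    (a + (- cv + cw * b)) * i
      ≈⟨ solve 5 (λ a n cw b i → (a :+ (n :+ cw :* b)) :* i := n :* i :+ i :* (a :+ b :* cw))
               refl a (- cv) cw b i ⟩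
    - cv * i + i * (a + b * cw)
      ≈⟨ +-congʳ (sym (-‿distribˡ-* cv i)) ⟩
    - (cv * i) + i * (a + b * cw)
      ∎
    where
    a = fst g
    b = snd g
    cv = fst ηv
    cw = fst ηw
    i = snd (ηv ⁻¹Γ)

  switch-vertexEntry : ∀ {n} (η : Fin n → Γ) g g′ u v w →
                       snd g′ ≈ snd ((η v ⁻¹Γ) ∘Γ (g ∘Γ η w)) →
                       snd (η u) * column g v w (suc u) * snd (η v ⁻¹Γ) ≈ column g′ v w (suc u)
  switch-vertexEntry η g g′ u v w b′≈ = begin
    q u * (δ u v + δ u w * - b) * i
      ≈⟨ solve 5 (λ q d d′ nb i → q :* (d :+ d′ :* nb) :* i :=
                                  d :* (q :* i) :+ d′ :* (q :* nb :* i))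
               refl (q u) (δ u v) (δ u w) (- b) i ⟩
    δ u v * (q u * i) + δ u w * (q u * - b * i)
      ≈⟨ +-congˡ (*-congˡ (x*-y*z≈-[x*y*z] (q u) b i)) ⟩
    δ u v * (q u * i) + δ u w * - (q u * b * i)
      ≈⟨ +-cong (δ-*-cong (λ x → q x * i) u v) (δ-*-cong (λ x → - (q x * b * i)) u w) ⟩
    δ u v * (q v * i) + δ u w * - (q w * b * i)
      ≈⟨ +-cong (*-congˡ (inverse (q v) (snd≉0 (η v)))) (*-congˡ (-‿cong qbi≈b′)) ⟩
    δ u v * 1# + δ u w * - snd g′
      ≈⟨ +-congʳ (*-identityʳ _) ⟩
    δ u v + δ u w * - snd g′
      ∎
    where
    q = snd ∘ η
    b = snd g
    i = snd (η v ⁻¹Γ)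

    qbi≈b′ : q w * b * i ≈ snd g′
    qbi≈b′ = trans (solve 3 (λ q b i → q :* b :* i := i :* (b :* q)) refl (q w) b i) (sym b′≈)

  ProjEquiv-switch : ∀ {n m} (v w : Fin m → Fin n) (t t′ : Fin m → Γ) (η : Fin n → Γ) →
                     (∀ e → t′ e ≈Γ ((η (v e) ⁻¹Γ) ∘Γ (t e ∘Γ η (w e)))) →
                     ProjEquiv (columns v w t) (columns v w t′)
  ProjEquiv-switch {n} v w t t′ η t′≈ =
    ProjEquiv-trans (ProjEquiv-addRowsToTop n id shift (columns v w t))
      (ProjEquiv-trans (ProjEquiv-scaleRows (one ∷ snd× ∘ η) _)
        (ProjEquiv-trans (ProjEquiv-scaleCols (λ e → snd× (η (v e) ⁻¹Γ)) _)
          (done switched)))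
    where
    shift : Fin n → Carrier
    shift u = - fst (η u)

    switched : scaleCols (λ e → snd (η (v e) ⁻¹Γ))
                 (scaleRows (proj₁ ∘ (one ∷ snd× ∘ η)) (addRowsToTop id shift (columns v w t)))
               ≋ columns v w t′
    switched zero e = begin
      1# * (fst (t e) + ∑[ u < n ] (shift u * column (t e) (v e) (w e) (suc u))) * snd (η (v e) ⁻¹Γ)
        ≈⟨ *-congʳ (trans (*-identityˡ _) (+-congˡ (∑-*column shift (t e) (v e) (w e)))) ⟩
      (fst (t e) + (shift (v e) + shift (w e) * - snd (t e))) * snd (η (v e) ⁻¹Γ)
        ≈⟨ switch-topEntry (t e) (η (v e)) (η (w e)) ⟩
      fst ((η (v e) ⁻¹Γ) ∘Γ (t e ∘Γ η (w e)))
        ≈⟨ sym (proj₁ (t′≈ e)) ⟩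
      fst (t′ e) ∎
    switched (suc u) e = switch-vertexEntry η (t e) (t′ e) u (v e) (w e) (proj₂ (t′≈ e))

lemma5p5 : ∀ {c ℓ : Level} (F : Field c ℓ) (G : Graph) (D : Orientation G)
           (ψ ψ' : GainGraphs.GainFunction F G) →
           GainGraphs.SwitchingEquivalent F G ψ ψ' →
           GainGraphs.ProjEquiv F (GainGraphs.A F G D ψ) (GainGraphs.A F G D ψ')
lemma5p5 F G D ψ ψ' (η , ψ'≈) =
  ProjEquiv-respˡ F (A≋columns F G D ψ)
    (ProjEquiv-respʳ F
      (ProjEquiv-switch F (source D) (target D) _ _ η (λ e → ψ'≈ e _ _ (proj₂ (D e))))
      (λ x e → Field.sym F (A≋columns F G D ψ' x e)))
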